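{- Let $w\in S_n$ contain the pattern $132$, and let $p=\max\{t : \exists\, i<t<j,\ w_i<w_j<w_t\}$ and $q=\max\{j : j>p,\ w_j<w_p,\ \exists\, i<p,\ w_i<w_j\}$. Then $\Psi(wt_{p,q},p)=\{w\}$.
   Context: Permutations are in one-line notation $u=u_1\cdots u_n$; $\ell(u)$ is the number of inversions of $u$. For positions $a<b$, $ut_{a,b}$ is the permutation obtained from $u$ by swapping $u_a$ and $u_b$. For $1\le k\le n$ let $S(u,k)=\{j>k : \ell(ut_{k,j})=\ell(u)+1\}$. Let $u\times 1=u_1u_2\cdots u_n(n+1)\in S_{n+1}$. Define recursively $\Psi(u,k)=\{ut_{k,j} : j\in S(u,k)\}$ if $S(u,k)\neq\emptyset$, and $\Psi(u,k)=\Psi(u\times 1,k)$ otherwise. -}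

module Defs where

open import Data.Nat using (ℕ; zero; suc; _<_; _≤_; _<ᵇ_; _≡ᵇ_)
open import Data.List using (List; []; _∷_; map; upTo; length; _++_; [_])
open import Data.Nat.ListAction using (sum)
open import Data.Bool using (Bool; true; false; if_then_else_; _∧_)
open import Data.Product using (_×_; ∃; ∃-syntax)
open import Relation.Binary.PropositionalEquality using (_≡_)
open import Relation.Nullary using (¬_)
open import Data.List.Relation.Binary.Permutation.Propositional using (_↭_)

-- Permutations are lists in one-line notation with values 1..n.
-- Positions are 1-based: w ! i = w_i for 1 ≤ i ≤ length w, and 0 otherwise.
_!_ : List ℕ → ℕ → ℕ
[] ! _ = 0
(x ∷ xs) ! zero = 0
(x ∷ xs) ! suc zero = x
(x ∷ xs) ! suc (suc i) = xs ! suc i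

positions : ℕ → List ℕ
positions n = map suc (upTo n)

IsPerm : ℕ → List ℕ → Set
IsPerm n w = w ↭ positions n

len : List ℕ → ℕ
len w = sum (map (λ a → sum (map (λ b → if (a <ᵇ b) ∧ ((w ! b) <ᵇ (w ! a)) then 1 else 0) pos)) pos)
  where
  pos = positions (length w)

swap : List ℕ → ℕ → ℕ → List ℕ
swap w a b = map (λ i → if i ≡ᵇ a then w ! b else (if i ≡ᵇ b then w ! a else w ! i)) (positions (length w))

InS : List ℕ → ℕ → ℕ → Set
InS u k j = k < j × j ≤ length u × len (swap u k j) ≡ suc (len u)

_×1 : List ℕ → List ℕ
u ×1 = u ++ [ suc (length u) ]

-- PsiMem u k v  means  v ∈ Ψ(u,k)  (inductive reading of the recursive definition)
data PsiMem : List ℕ → ℕ → List ℕ → Set where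
  direct : ∀ {u k j} → InS u k j → PsiMem u k (swap u k j)
  extend : ∀ {u k v} → ¬ (∃[ j ] InS u k j) → PsiMem (u ×1) k v → PsiMem u k v

Mid132 : List ℕ → ℕ → Set
Mid132 w t = ∃[ i ] ∃[ j ] (1 ≤ i × i < t × t < j × j ≤ length w × (w ! i) < (w ! j) × (w ! j) < (w ! t))

Contains132 : List ℕ → Set
Contains132 w = ∃[ t ] Mid132 w t

QSet : List ℕ → ℕ → ℕ → Set
QSet w p j = p < j × j ≤ length w × (w ! j) < (w ! p) × ∃[ i ] (1 ≤ i × i < p × (w ! i) < (w ! j))

IsMax : (ℕ → Set) → ℕ → Set
IsMax P m = P m × (∀ t → P t → t ≤ m)

-- Writing ℓ as a double sum of inversion indicators, exchanging the entries at positions a < b of a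
-- sequence F with distinct values and F a < F b raises ℓ by exactly 1 + 2·#{a < c < b : F a < F c < F b}.
-- Hence j ∈ S(u,k) iff u_k < u_j and no position strictly between k and j carries a value strictly
-- between u_k and u_j.  For u = w t_{p,q} we have u_p = w_q < w_p = u_q, and a position c ∈ (p,q) with
-- w_q < w_c would make (i, c, q) a 132 with middle c > p (i being the witness in the definition of q);
-- so q ∈ S(u,p).  A j ∈ S(u,p) with j < q gives the same kind of 132; one with j > q lies in the set
-- defining q if w_j < w_p, and is blocked by the position q if w_j > w_p.  So S(u,p) = {q}, the
-- recursion of Ψ stops at once, and Ψ(u,p) = {u t_{p,q}} = {w}.
module Submission where

open import Defs
open import Data.Nat using (ℕ; zero; suc; _+_; _<_; _≤_; _<ᵇ_; _≡ᵇ_; z≤n; s≤s)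
open import Data.Nat.Properties
open import Data.Nat.Tactic.RingSolver using (solve-∀)
open import Data.Nat.ListAction using (sum)
open import Data.Nat.ListAction.Properties using (sum-++)
open import Data.Bool using (Bool; true; false; if_then_else_; _∧_)
open import Data.Bool.Properties using (∧-zeroʳ; if-float; T-≡)
open import Data.List using (List; []; _∷_; map; upTo; applyUpTo; length; _++_; [_])
open import Data.List.Properties using (map-++; upTo-∷ʳ; map-cong; map-applyUpTo; length-applyUpTo)
open import Data.List.Relation.Unary.All using (All; _∷_)
open import Data.List.Relation.Unary.AllPairs using (_∷_)
open import Data.List.Relation.Unary.Unique.Propositional using (Unique)
open import Data.List.Relation.Unary.Unique.Propositional.Properties using (map⁺; upTo⁺)
open import Data.List.Relation.Binary.Permutation.Propositional using (↭-sym; ↭⇒↭ₛ)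
open import Data.Product using (_×_; _,_; proj₁; proj₂)
open import Data.Sum using (inj₁; inj₂)
open import Data.Empty using (⊥-elim)
open import Function using (_∘_; Equivalence)
open import Relation.Nullary using (¬_; yes; no)
open import Relation.Binary.Definitions using (tri<; tri≈; tri>)
open import Relation.Binary.PropositionalEquality hiding ([_])
open import Data.List.Relation.Binary.Permutation.Setoid.Properties (setoid ℕ) using (Unique-resp-↭)

<ᵇ-true : ∀ {m n} → m < n → (m <ᵇ n) ≡ true
<ᵇ-true m<n = Equivalence.to T-≡ (<⇒<ᵇ m<n)

<ᵇ-false : ∀ {m n} → n ≤ m → (m <ᵇ n) ≡ false
<ᵇ-false {m} {zero} _ = refl
<ᵇ-false {suc m} {suc n} (s≤s n≤m) = <ᵇ-false n≤m

≡ᵇ-refl : ∀ n → (n ≡ᵇ n) ≡ true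
≡ᵇ-refl n = Equivalence.to T-≡ (≡⇒≡ᵇ n n refl)

≡ᵇ-false : ∀ {m n} → m ≢ n → (m ≡ᵇ n) ≡ false
≡ᵇ-false {zero} {zero} m≢n = ⊥-elim (m≢n refl)
≡ᵇ-false {zero} {suc n} _ = refl
≡ᵇ-false {suc m} {zero} _ = refl
≡ᵇ-false {suc m} {suc n} m≢n = ≡ᵇ-false (m≢n ∘ cong suc)

ind : Bool → ℕ
ind b = if b then 1 else 0

when : Bool → ℕ → ℕ
when b v = if b then v else 0

when-false : ∀ {b} v → b ≡ false → when b v ≡ 0
when-false v refl = refl

when-true : ∀ {b} v → b ≡ true → when b v ≡ v
when-true v refl = refl

sumTo : ℕ → (ℕ → ℕ) → ℕ
sumTo n h = sum (map h (positions n))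

sumTo-suc : ∀ n h → sumTo (suc n) h ≡ sumTo n h + h (suc n)
sumTo-suc n h = begin
  sum (map h (map suc (upTo (suc n))))
    ≡⟨ cong (λ l → sum (map h (map suc l))) (sym (upTo-∷ʳ n)) ⟩
  sum (map h (map suc (upTo n ++ [ n ])))
    ≡⟨ cong (λ l → sum (map h l)) (map-++ suc (upTo n) [ n ]) ⟩
  sum (map h (positions n ++ [ suc n ]))
    ≡⟨ cong sum (map-++ h (positions n) [ suc n ]) ⟩
  sum (map h (positions n) ++ [ h (suc n) ])
    ≡⟨ sum-++ (map h (positions n)) [ h (suc n) ] ⟩
  sumTo n h + (h (suc n) + 0)
    ≡⟨ cong (sumTo n h +_) (+-identityʳ _) ⟩
  sumTo n h + h (suc n) ∎
  where open ≡-Reasoning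

sumTo-cong : ∀ n {h k : ℕ → ℕ} → (∀ y → h y ≡ k y) → sumTo n h ≡ sumTo n k
sumTo-cong n h≗k = cong sum (map-cong h≗k (positions n))

sumTo-+ : ∀ n (h k : ℕ → ℕ) → sumTo n (λ y → h y + k y) ≡ sumTo n h + sumTo n k
sumTo-+ zero h k = refl
sumTo-+ (suc n) h k = begin
  sumTo (suc n) (λ y → h y + k y)                     ≡⟨ sumTo-suc n _ ⟩
  sumTo n (λ y → h y + k y) + (h (suc n) + k (suc n)) ≡⟨ cong (_+ (h (suc n) + k (suc n))) (sumTo-+ n h k) ⟩
  sumTo n h + sumTo n k + (h (suc n) + k (suc n))     ≡⟨ interchange (sumTo n h) _ _ _ ⟩
  sumTo n h + h (suc n) + (sumTo n k + k (suc n))     ≡⟨ cong₂ _+_ (sym (sumTo-suc n h)) (sym (sumTo-suc n k)) ⟩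
  sumTo (suc n) h + sumTo (suc n) k                   ∎
  where
  open ≡-Reasoning
  interchange : ∀ x y z t → x + y + (z + t) ≡ x + z + (y + t)
  interchange = solve-∀

sumTo-+₃ : ∀ n (h k l : ℕ → ℕ) → sumTo n (λ y → h y + k y + l y) ≡ sumTo n h + sumTo n k + sumTo n l
sumTo-+₃ n h k l = trans (sumTo-+ n (λ y → h y + k y) l) (cong (_+ sumTo n l) (sumTo-+ n h k))

sumTo-zero : ∀ n (h : ℕ → ℕ) → (∀ y → 1 ≤ y → y ≤ n → h y ≡ 0) → sumTo n h ≡ 0
sumTo-zero zero h _ = refl
sumTo-zero (suc n) h h≗0 = trans (sumTo-suc n h)
  (cong₂ _+_ (sumTo-zero n h (λ y 1≤y y≤n → h≗0 y 1≤y (m≤n⇒m≤1+n y≤n))) (h≗0 (suc n) (s≤s z≤n) ≤-refl))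

sumTo≡0⇒ : ∀ n (h : ℕ → ℕ) → sumTo n h ≡ 0 → ∀ y → 1 ≤ y → y ≤ n → h y ≡ 0
sumTo≡0⇒ zero h _ y 1≤y y≤0 = ⊥-elim (<-irrefl refl (≤-trans 1≤y y≤0))
sumTo≡0⇒ (suc n) h sum≡0 y 1≤y y≤n+1 with m≤n⇒m<n∨m≡n y≤n+1
... | inj₁ y≤n = sumTo≡0⇒ n h (m+n≡0⇒m≡0 (sumTo n h) split) y 1≤y (≤-pred y≤n)
  where split = trans (sym (sumTo-suc n h)) sum≡0
... | inj₂ refl = m+n≡0⇒n≡0 (sumTo n h) (trans (sym (sumTo-suc n h)) sum≡0)

single : ℕ → ℕ → ℕ → ℕ
single c t y = when (y ≡ᵇ c) t

single-at : ∀ c t → single c t c ≡ t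
single-at c t = when-true t (≡ᵇ-refl c)

single-off : ∀ {c y} t → y ≢ c → single c t y ≡ 0
single-off t y≢c = when-false t (≡ᵇ-false y≢c)

sumTo-single : ∀ n {c} t → 1 ≤ c → c ≤ n → sumTo n (single c t) ≡ t
sumTo-single zero t 1≤c c≤0 = ⊥-elim (<-irrefl refl (≤-trans 1≤c c≤0))
sumTo-single (suc n) {c} t 1≤c c≤n+1 with m≤n⇒m<n∨m≡n c≤n+1
... | inj₁ c≤n = begin
  sumTo (suc n) (single c t)                ≡⟨ sumTo-suc n _ ⟩
  sumTo n (single c t) + single c t (suc n) ≡⟨ cong₂ _+_ (sumTo-single n t 1≤c (≤-pred c≤n)) (single-off t (≢-sym (<⇒≢ c≤n))) ⟩
  t + 0                                     ≡⟨ +-identityʳ t ⟩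
  t                                         ∎
  where open ≡-Reasoning
... | inj₂ refl = begin
  sumTo (suc n) (single c t)                ≡⟨ sumTo-suc n _ ⟩
  sumTo n (single c t) + single c t c       ≡⟨ cong₂ _+_ (sumTo-zero n _ below) (single-at c t) ⟩
  t                                         ∎
  where
  open ≡-Reasoning
  below : ∀ y → 1 ≤ y → y ≤ n → single c t y ≡ 0
  below y _ y≤n = single-off t (<⇒≢ (s≤s y≤n))

-- Σ H − H a − H b = Σ K − K a − K b, with both sides moved so that no subtraction occurs.
sumTo-exchange : ∀ n {a b} (H K : ℕ → ℕ) → 1 ≤ a → a ≤ n → 1 ≤ b → b ≤ n → a ≢ b →
                 (∀ y → y ≢ a → y ≢ b → H y ≡ K y) → sumTo n H + K a + K b ≡ sumTo n K + H a + H b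
sumTo-exchange n {a} {b} H K 1≤a a≤n 1≤b b≤n a≢b H≗K = begin
  sumTo n H + K a + K b
    ≡⟨ cong₂ (λ s t → sumTo n H + s + t) (sym (sumTo-single n (K a) 1≤a a≤n)) (sym (sumTo-single n (K b) 1≤b b≤n)) ⟩
  sumTo n H + sumTo n (single a (K a)) + sumTo n (single b (K b)) ≡⟨ sym (sumTo-+₃ n _ _ _) ⟩
  sumTo n (λ y → H y + single a (K a) y + single b (K b) y)    ≡⟨ sumTo-cong n pointwise ⟩
  sumTo n (λ y → K y + single a (H a) y + single b (H b) y)    ≡⟨ sumTo-+₃ n _ _ _ ⟩
  sumTo n K + sumTo n (single a (H a)) + sumTo n (single b (H b))
    ≡⟨ cong₂ (λ s t → sumTo n K + s + t) (sumTo-single n (H a) 1≤a a≤n) (sumTo-single n (H b) 1≤b b≤n) ⟩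
  sumTo n K + H a + H b ∎
  where
  open ≡-Reasoning
  exchange-ends : ∀ x y → x + 0 + y ≡ y + 0 + x
  exchange-ends = solve-∀
  pointwise : ∀ y → H y + single a (K a) y + single b (K b) y ≡ K y + single a (H a) y + single b (H b) y
  pointwise y with y ≟ a | y ≟ b
  ... | yes refl | _
    rewrite single-at a (K a) | single-at a (H a) | single-off {b} (K b) a≢b | single-off {b} (H b) a≢b
    = cong (_+ 0) (+-comm (H a) (K a))
  ... | no y≢a | yes refl
    rewrite single-at b (K b) | single-at b (H b) | single-off {a} (K a) y≢a | single-off {a} (H a) y≢a
    = exchange-ends (H b) (K b)
  ... | no y≢a | no y≢b
    rewrite single-off {a} (K a) y≢a | single-off {a} (H a) y≢a | single-off {b} (K b) y≢b | single-off {b} (H b) y≢b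
    = cong (λ t → t + 0 + 0) (H≗K y y≢a y≢b)

inv : (ℕ → ℕ) → ℕ → ℕ → ℕ
inv f x y = ind ((x <ᵇ y) ∧ (f y <ᵇ f x))

inversionsFrom : (ℕ → ℕ) → ℕ → ℕ → ℕ
inversionsFrom f n x = sumTo n (inv f x)

inversions : (ℕ → ℕ) → ℕ → ℕ
inversions f n = sumTo n (inversionsFrom f n)

len≡inversions : ∀ L → len L ≡ inversions (L !_) (length L)
len≡inversions L = refl

inv-≥ : ∀ f {x y} → y ≤ x → inv f x y ≡ 0
inv-≥ f {x} {y} y≤x = cong (λ t → ind (t ∧ (f y <ᵇ f x))) (<ᵇ-false y≤x)

inv-< : ∀ f {x y} → x < y → inv f x y ≡ ind (f y <ᵇ f x)
inv-< f {x} {y} x<y = cong (λ t → ind (t ∧ (f y <ᵇ f x))) (<ᵇ-true x<y)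

strictlyBetween : ℕ → ℕ → ℕ → Bool
strictlyBetween a b y = (a <ᵇ y) ∧ (y <ᵇ b)

strictlyBetween-true : ∀ {a b y} → a < y → y < b → strictlyBetween a b y ≡ true
strictlyBetween-true a<y y<b = cong₂ _∧_ (<ᵇ-true a<y) (<ᵇ-true y<b)

strictlyBetween-≤ : ∀ {a b y} → y ≤ a → strictlyBetween a b y ≡ false
strictlyBetween-≤ {b = b} {y} y≤a = cong (_∧ (y <ᵇ b)) (<ᵇ-false y≤a)

strictlyBetween-≥ : ∀ {a b y} → b ≤ y → strictlyBetween a b y ≡ false
strictlyBetween-≥ {a} {y = y} b≤y = trans (cong ((a <ᵇ y) ∧_) (<ᵇ-false b≤y)) (∧-zeroʳ _)

sandwiched : (ℕ → ℕ) → ℕ → ℕ → ℕ → ℕ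
sandwiched f a b y = when (strictlyBetween a b y) (ind ((f a <ᵇ f y) ∧ (f y <ᵇ f b)))

sandwiched-≤ : ∀ f {a b y} → y ≤ a → sandwiched f a b y ≡ 0
sandwiched-≤ f {b = b} y≤a = when-false _ (strictlyBetween-≤ {b = b} y≤a)

sandwiched-≥ : ∀ f {a b y} → b ≤ y → sandwiched f a b y ≡ 0
sandwiched-≥ f {a} b≤y = when-false _ (strictlyBetween-≥ {a} b≤y)

sandwiched-between : ∀ f {a b y} → a < y → y < b → sandwiched f a b y ≡ ind ((f a <ᵇ f y) ∧ (f y <ᵇ f b))
sandwiched-between f {a} {b} a<y y<b = when-true _ (strictlyBetween-true a<y y<b)

record Transposed (a b : ℕ) (F G : ℕ → ℕ) : Set where
  field
    at-a : G a ≡ F b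
    at-b : G b ≡ F a
    elsewhere : ∀ y → y ≢ a → y ≢ b → G y ≡ F y

Transposed-sym : ∀ {a b F G} → Transposed a b F G → Transposed a b G F
Transposed-sym F↔G = record
  { at-a = sym at-b ; at-b = sym at-a ; elsewhere = λ y y≢a y≢b → sym (elsewhere y y≢a y≢b) }
  where open Transposed F↔G

value-crossings : ∀ {u v z} → u < v → z ≢ u → z ≢ v →
  ind (u <ᵇ z) + ind (z <ᵇ v) ≡ ind (v <ᵇ z) + ind (z <ᵇ u) + (ind ((u <ᵇ z) ∧ (z <ᵇ v)) + ind ((u <ᵇ z) ∧ (z <ᵇ v)))
value-crossings {u} {v} {z} u<v z≢u z≢v with <-cmp z u
... | tri≈ _ z≡u _ = ⊥-elim (z≢u z≡u)
... | tri< z<u _ _ rewrite <ᵇ-false (<⇒≤ z<u) | <ᵇ-true z<u | <ᵇ-true (<-trans z<u u<v) | <ᵇ-false (<⇒≤ (<-trans z<u u<v)) = refl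
... | tri> _ _ u<z with <-cmp z v
...   | tri≈ _ z≡v _ = ⊥-elim (z≢v z≡v)
...   | tri< z<v _ _ rewrite <ᵇ-true u<z | <ᵇ-false (<⇒≤ u<z) | <ᵇ-true z<v | <ᵇ-false (<⇒≤ z<v) = refl
...   | tri> _ _ v<z rewrite <ᵇ-true u<z | <ᵇ-false (<⇒≤ u<z) | <ᵇ-true v<z | <ᵇ-false (<⇒≤ v<z) = refl

shift-difference : ∀ t t' s {s' c} → t + s ≡ t' + s' → s' ≡ s + c → t ≡ t' + c
shift-difference t t' s {c = c} t+s≡t'+s' refl = +-cancelʳ-≡ s t (t' + c) (trans t+s≡t'+s' (regroup t' s c))
  where
  regroup : ∀ x y z → x + (y + z) ≡ x + z + y
  regroup = solve-∀

drop-zeros : ∀ p q {A B C D} → A ≡ 0 → C ≡ 0 → p + A + B ≡ q + C + D → p + B ≡ q + D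
drop-zeros p q {B = B} {D = D} refl refl eq =
  trans (cong (_+ B) (sym (+-identityʳ p))) (trans eq (cong (_+ D) (+-identityʳ q)))

module InversionsOfTransposition {n a b : ℕ} {F G : ℕ → ℕ} (1≤a : 1 ≤ a) (a<b : a < b) (b≤n : b ≤ n)
                                 (F↔G : Transposed a b F G) where

  open Transposed F↔G
  open ≡-Reasoning

  1≤b : 1 ≤ b
  1≤b = ≤-trans 1≤a (<⇒≤ a<b)

  a≤n : a ≤ n
  a≤n = ≤-trans (<⇒≤ a<b) b≤n

  a≢b : a ≢ b
  a≢b = <⇒≢ a<b

  -- In a row x ∉ {a, b} the exchange changes the number of inversions only if a < x < b, and then
  -- only through the pair (x, b).
  viaB : (ℕ → ℕ) → ℕ → ℕ
  viaB f x = when (strictlyBetween a b x) (inv f x b)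

  viaB-≤ : ∀ f {x} → x ≤ a → viaB f x ≡ 0
  viaB-≤ f x≤a = when-false _ (strictlyBetween-≤ {b = b} x≤a)

  viaB-≥ : ∀ f {x} → b ≤ x → viaB f x ≡ 0
  viaB-≥ f b≤x = when-false _ (strictlyBetween-≥ {a} b≤x)

  viaB-between : ∀ f {x} → a < x → x < b → viaB f x ≡ inv f x b
  viaB-between f a<x x<b = when-true _ (strictlyBetween-true {a} {b} a<x x<b)

  inv-unmoved : ∀ {x} → x ≢ a → x ≢ b → ∀ y → y ≢ a → y ≢ b → inv G x y ≡ inv F x y
  inv-unmoved {x} x≢a x≢b y y≢a y≢b =
    cong₂ (λ s t → ind ((x <ᵇ y) ∧ (s <ᵇ t))) (elsewhere y y≢a y≢b) (elsewhere x x≢a x≢b)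

  row-exchange : ∀ {x} → x ≢ a → x ≢ b →
                 inversionsFrom G n x + inv F x a + inv F x b ≡ inversionsFrom F n x + inv G x a + inv G x b
  row-exchange x≢a x≢b = sumTo-exchange n _ _ 1≤a a≤n 1≤b b≤n a≢b (inv-unmoved x≢a x≢b)

  inversionsFrom-unmoved : ∀ x → x ≢ a → x ≢ b → inversionsFrom G n x + viaB F x ≡ inversionsFrom F n x + viaB G x
  inversionsFrom-unmoved x x≢a x≢b with <-cmp x a
  ... | tri≈ _ x≡a _ = ⊥-elim (x≢a x≡a)
  ... | tri< x<a _ _ = cong₂ _+_ same-row (trans (viaB-≤ F (<⇒≤ x<a)) (sym (viaB-≤ G (<⇒≤ x<a))))
    where
    x<b = <-trans x<a a<b
    Gxa≡Fxb : inv G x a ≡ inv F x b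
    Gxa≡Fxb = trans (inv-< G x<a) (trans (cong₂ (λ s t → ind (s <ᵇ t)) at-a (elsewhere x x≢a x≢b)) (sym (inv-< F x<b)))
    Gxb≡Fxa : inv G x b ≡ inv F x a
    Gxb≡Fxa = trans (inv-< G x<b) (trans (cong₂ (λ s t → ind (s <ᵇ t)) at-b (elsewhere x x≢a x≢b)) (sym (inv-< F x<a)))
    same-row : inversionsFrom G n x ≡ inversionsFrom F n x
    same-row = +-cancelʳ-≡ (inv F x a + inv F x b) _ _ (begin
      inversionsFrom G n x + (inv F x a + inv F x b) ≡⟨ sym (+-assoc (inversionsFrom G n x) _ _) ⟩
      inversionsFrom G n x + inv F x a + inv F x b   ≡⟨ row-exchange x≢a x≢b ⟩
      inversionsFrom F n x + inv G x a + inv G x b   ≡⟨ cong₂ (λ s t → inversionsFrom F n x + s + t) Gxa≡Fxb Gxb≡Fxa ⟩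
      inversionsFrom F n x + inv F x b + inv F x a   ≡⟨ +-assoc (inversionsFrom F n x) _ _ ⟩
      inversionsFrom F n x + (inv F x b + inv F x a) ≡⟨ cong (inversionsFrom F n x +_) (+-comm (inv F x b) _) ⟩
      inversionsFrom F n x + (inv F x a + inv F x b) ∎)
  ... | tri> _ _ a<x with <-cmp x b
  ...   | tri≈ _ x≡b _ = ⊥-elim (x≢b x≡b)
  ...   | tri< x<b _ _ = begin
    inversionsFrom G n x + viaB F x  ≡⟨ cong (inversionsFrom G n x +_) (viaB-between F a<x x<b) ⟩
    inversionsFrom G n x + inv F x b ≡⟨ drop-zeros (inversionsFrom G n x) (inversionsFrom F n x) (inv-≥ F (<⇒≤ a<x)) (inv-≥ G (<⇒≤ a<x)) (row-exchange x≢a x≢b) ⟩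
    inversionsFrom F n x + inv G x b ≡⟨ cong (inversionsFrom F n x +_) (sym (viaB-between G a<x x<b)) ⟩
    inversionsFrom F n x + viaB G x  ∎
  ...   | tri> _ _ b<x = begin
    inversionsFrom G n x + viaB F x  ≡⟨ cong (inversionsFrom G n x +_) (trans (viaB-≥ F (<⇒≤ b<x)) (sym (inv-≥ F (<⇒≤ b<x)))) ⟩
    inversionsFrom G n x + inv F x b ≡⟨ drop-zeros (inversionsFrom G n x) (inversionsFrom F n x) (inv-≥ F (<⇒≤ a<x)) (inv-≥ G (<⇒≤ a<x)) (row-exchange x≢a x≢b) ⟩
    inversionsFrom F n x + inv G x b ≡⟨ cong (inversionsFrom F n x +_) (trans (inv-≥ G (<⇒≤ b<x)) (sym (viaB-≥ G (<⇒≤ b<x)))) ⟩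
    inversionsFrom F n x + viaB G x  ∎

  rows : inversions G n + (sumTo n (viaB F) + inversionsFrom F n a + inversionsFrom F n b)
       ≡ inversions F n + (sumTo n (viaB G) + inversionsFrom G n a + inversionsFrom G n b)
  rows = begin
    inversions G n + (sumTo n (viaB F) + inversionsFrom F n a + inversionsFrom F n b)
      ≡⟨ pad-zeros (inversions G n) (sumTo n (viaB F)) _ _ ⟩
    inversions G n + sumTo n (viaB F) + (inversionsFrom F n a + 0) + (inversionsFrom F n b + 0)
      ≡⟨ cong₂ (λ s t → inversions G n + sumTo n (viaB F) + (inversionsFrom F n a + s) + (inversionsFrom F n b + t))
               (sym (viaB-≤ G ≤-refl)) (sym (viaB-≥ G ≤-refl)) ⟩
    inversions G n + sumTo n (viaB F) + (inversionsFrom F n a + viaB G a) + (inversionsFrom F n b + viaB G b)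
      ≡⟨ cong (λ s → s + (inversionsFrom F n a + viaB G a) + (inversionsFrom F n b + viaB G b))
              (sym (sumTo-+ n (inversionsFrom G n) (viaB F))) ⟩
    sumTo n (λ x → inversionsFrom G n x + viaB F x) + (inversionsFrom F n a + viaB G a) + (inversionsFrom F n b + viaB G b)
      ≡⟨ sumTo-exchange n _ _ 1≤a a≤n 1≤b b≤n a≢b inversionsFrom-unmoved ⟩
    sumTo n (λ x → inversionsFrom F n x + viaB G x) + (inversionsFrom G n a + viaB F a) + (inversionsFrom G n b + viaB F b)
      ≡⟨ cong (λ s → s + (inversionsFrom G n a + viaB F a) + (inversionsFrom G n b + viaB F b))
              (sumTo-+ n (inversionsFrom F n) (viaB G)) ⟩
    inversions F n + sumTo n (viaB G) + (inversionsFrom G n a + viaB F a) + (inversionsFrom G n b + viaB F b)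
      ≡⟨ cong₂ (λ s t → inversions F n + sumTo n (viaB G) + (inversionsFrom G n a + s) + (inversionsFrom G n b + t))
               (viaB-≤ F ≤-refl) (viaB-≥ F ≤-refl) ⟩
    inversions F n + sumTo n (viaB G) + (inversionsFrom G n a + 0) + (inversionsFrom G n b + 0)
      ≡⟨ sym (pad-zeros (inversions F n) (sumTo n (viaB G)) _ _) ⟩
    inversions F n + (sumTo n (viaB G) + inversionsFrom G n a + inversionsFrom G n b) ∎
    where
    pad-zeros : ∀ t s x y → t + (s + x + y) ≡ t + s + (x + 0) + (y + 0)
    pad-zeros = solve-∀

  module _ (Fa<Fb : F a < F b) (distinct : ∀ c → a < c → c < b → F c ≢ F a × F c ≢ F b) where

    column : ∀ y → viaB G y + inv G a y + inv G b y
                 ≡ viaB F y + inv F a y + inv F b y + (single b 1 y + (sandwiched F a b y + sandwiched F a b y))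
    column y with <-cmp y a | <-cmp y b
    ... | tri< y<a _ _ | _
      rewrite viaB-≤ G (<⇒≤ y<a) | viaB-≤ F (<⇒≤ y<a) | sandwiched-≤ F {b = b} (<⇒≤ y<a)
            | inv-≥ G {a} (<⇒≤ y<a) | inv-≥ F {a} (<⇒≤ y<a)
            | inv-≥ G {b} (<⇒≤ (<-trans y<a a<b)) | inv-≥ F {b} (<⇒≤ (<-trans y<a a<b))
            | single-off {b} 1 (<⇒≢ (<-trans y<a a<b)) = refl
    ... | tri≈ _ refl _ | _
      rewrite viaB-≤ G (≤-refl {y}) | viaB-≤ F (≤-refl {y}) | sandwiched-≤ F {b = b} (≤-refl {y})
            | inv-≥ G {y} (≤-refl {y}) | inv-≥ F {y} (≤-refl {y})
            | inv-≥ G {b} (<⇒≤ a<b) | inv-≥ F {b} (<⇒≤ a<b)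
            | single-off {b} 1 a≢b = refl
    ... | tri> _ _ a<y | tri< y<b _ _
      rewrite viaB-between G a<y y<b | viaB-between F a<y y<b | sandwiched-between F a<y y<b
            | inv-< G y<b | inv-< F y<b | inv-< G a<y | inv-< F a<y
            | inv-≥ G {b} (<⇒≤ y<b) | inv-≥ F {b} (<⇒≤ y<b)
            | single-off {b} 1 (<⇒≢ y<b) | at-a | at-b | elsewhere y (≢-sym (<⇒≢ a<y)) (<⇒≢ y<b)
            | +-identityʳ (ind (F a <ᵇ F y) + ind (F y <ᵇ F b)) | +-identityʳ (ind (F b <ᵇ F y) + ind (F y <ᵇ F a))
      = value-crossings Fa<Fb (proj₁ (distinct y a<y y<b)) (proj₂ (distinct y a<y y<b))
    ... | tri> _ _ a<y | tri≈ _ refl _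
      rewrite viaB-≥ G (≤-refl {y}) | viaB-≥ F (≤-refl {y}) | sandwiched-≥ F {a} (≤-refl {y})
            | inv-< G a<y | inv-< F a<y | inv-≥ G {y} (≤-refl {y}) | inv-≥ F {y} (≤-refl {y})
            | single-at y 1 | at-a | at-b | <ᵇ-true Fa<Fb | <ᵇ-false (<⇒≤ Fa<Fb) = refl
    ... | tri> _ _ a<y | tri> _ _ b<y
      rewrite viaB-≥ G (<⇒≤ b<y) | viaB-≥ F (<⇒≤ b<y) | sandwiched-≥ F {a} (<⇒≤ b<y)
            | inv-< G a<y | inv-< F a<y | inv-< G b<y | inv-< F b<y
            | single-off {b} 1 (≢-sym (<⇒≢ b<y))
            | at-a | at-b | elsewhere y (≢-sym (<⇒≢ a<y)) (≢-sym (<⇒≢ b<y))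
      = trans (+-comm (ind (F y <ᵇ F b)) _) (sym (+-identityʳ _))

    columns : sumTo n (viaB G) + inversionsFrom G n a + inversionsFrom G n b
            ≡ sumTo n (viaB F) + inversionsFrom F n a + inversionsFrom F n b
              + suc (sumTo n (sandwiched F a b) + sumTo n (sandwiched F a b))
    columns = begin
      sumTo n (viaB G) + inversionsFrom G n a + inversionsFrom G n b
        ≡⟨ sym (sumTo-+₃ n (viaB G) (inv G a) (inv G b)) ⟩
      sumTo n (λ y → viaB G y + inv G a y + inv G b y)
        ≡⟨ sumTo-cong n column ⟩
      sumTo n (λ y → viaB F y + inv F a y + inv F b y + (single b 1 y + (sandwiched F a b y + sandwiched F a b y)))
        ≡⟨ sumTo-+ n (λ y → viaB F y + inv F a y + inv F b y) (λ y → single b 1 y + (sandwiched F a b y + sandwiched F a b y)) ⟩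
      sumTo n (λ y → viaB F y + inv F a y + inv F b y) + sumTo n (λ y → single b 1 y + (sandwiched F a b y + sandwiched F a b y))
        ≡⟨ cong₂ _+_ (sumTo-+₃ n (viaB F) (inv F a) (inv F b))
                     (trans (sumTo-+ n (single b 1) (λ y → sandwiched F a b y + sandwiched F a b y))
                            (cong₂ _+_ (sumTo-single n 1 1≤b b≤n) (sumTo-+ n (sandwiched F a b) (sandwiched F a b)))) ⟩
      sumTo n (viaB F) + inversionsFrom F n a + inversionsFrom F n b
        + suc (sumTo n (sandwiched F a b) + sumTo n (sandwiched F a b)) ∎

    inversions-transposed : inversions G n ≡ inversions F n + suc (sumTo n (sandwiched F a b) + sumTo n (sandwiched F a b))
    inversions-transposed = shift-difference (inversions G n) (inversions F n) _ rows columns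

inversions-transposition : ∀ n {a b} {F G : ℕ → ℕ} → 1 ≤ a → a < b → b ≤ n → Transposed a b F G →
  F a < F b → (∀ c → a < c → c < b → F c ≢ F a × F c ≢ F b) →
  inversions G n ≡ inversions F n + suc (sumTo n (sandwiched F a b) + sumTo n (sandwiched F a b))
inversions-transposition n 1≤a a<b b≤n F↔G = InversionsOfTransposition.inversions-transposed 1≤a a<b b≤n F↔G

lookup-zero : ∀ L → L ! 0 ≡ 0
lookup-zero [] = refl
lookup-zero (x ∷ L) = refl

lookup-beyond : ∀ L {i} → length L < i → L ! i ≡ 0
lookup-beyond [] _ = refl
lookup-beyond (x ∷ L) {suc zero} (s≤s ())
lookup-beyond (x ∷ L) {suc (suc i)} (s≤s len<i+1) = lookup-beyond L len<i+1

lookup-applyUpTo : ∀ (g : ℕ → ℕ) n {i} → i < n → applyUpTo g n ! suc i ≡ g i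
lookup-applyUpTo g (suc n) {zero} _ = refl
lookup-applyUpTo g (suc n) {suc i} (s≤s i<n) = lookup-applyUpTo (g ∘ suc) n i<n

map-positions : ∀ (h : ℕ → ℕ) n → map h (positions n) ≡ applyUpTo (h ∘ suc) n
map-positions h n = trans (cong (map h) (map-applyUpTo (λ i → i) suc n)) (map-applyUpTo suc h n)

length-map-positions : ∀ (h : ℕ → ℕ) n → length (map h (positions n)) ≡ n
length-map-positions h n = trans (cong length (map-positions h n)) (length-applyUpTo _ n)

lookup-map-positions : ∀ (h : ℕ → ℕ) n {y} → 1 ≤ y → y ≤ n → map h (positions n) ! y ≡ h y
lookup-map-positions h n {suc y} _ y<n = trans (cong (_! suc y) (map-positions h n)) (lookup-applyUpTo (h ∘ suc) n y<n)

lookup-map-positions-beyond : ∀ (h : ℕ → ℕ) n {y} → n < y → map h (positions n) ! y ≡ 0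
lookup-map-positions-beyond h n n<y = lookup-beyond (map h (positions n)) (subst (_< _) (sym (length-map-positions h n)) n<y)

length-swap : ∀ L a b → length (swap L a b) ≡ length L
length-swap L a b = length-map-positions _ (length L)

transpose : ℕ → ℕ → ℕ → ℕ
transpose a b y = if y ≡ᵇ a then b else (if y ≡ᵇ b then a else y)

transpose-a : ∀ a b → transpose a b a ≡ b
transpose-a a b rewrite ≡ᵇ-refl a = refl

transpose-b : ∀ {a b} → a ≢ b → transpose a b b ≡ a
transpose-b {a} {b} a≢b rewrite ≡ᵇ-false (≢-sym a≢b) | ≡ᵇ-refl b = refl

transpose-other : ∀ {a b y} → y ≢ a → y ≢ b → transpose a b y ≡ y
transpose-other y≢a y≢b rewrite ≡ᵇ-false y≢a | ≡ᵇ-false y≢b = refl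

transpose-involutive : ∀ {a b} → a ≢ b → ∀ y → transpose a b (transpose a b y) ≡ y
transpose-involutive {a} {b} a≢b y with y ≟ a | y ≟ b
... | yes refl | _ = trans (cong (transpose a b) (transpose-a a b)) (transpose-b a≢b)
... | no _ | yes refl = trans (cong (transpose a b) (transpose-b a≢b)) (transpose-a a b)
... | no y≢a | no y≢b = trans (cong (transpose a b) (transpose-other y≢a y≢b)) (transpose-other y≢a y≢b)

transpose-inRange : ∀ {n a b y} → 1 ≤ a → a ≤ n → 1 ≤ b → b ≤ n → a ≢ b → 1 ≤ y → y ≤ n →
                    1 ≤ transpose a b y × transpose a b y ≤ n
transpose-inRange {n} {a} {b} {y} 1≤a a≤n 1≤b b≤n a≢b 1≤y y≤n with y ≟ a | y ≟ b
... | yes refl | _ = subst (λ t → 1 ≤ t × t ≤ n) (sym (transpose-a a b)) (1≤b , b≤n)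
... | no _ | yes refl = subst (λ t → 1 ≤ t × t ≤ n) (sym (transpose-b a≢b)) (1≤a , a≤n)
... | no y≢a | no y≢b = subst (λ t → 1 ≤ t × t ≤ n) (sym (transpose-other y≢a y≢b)) (1≤y , y≤n)

lookup-swap : ∀ L {a b} → 1 ≤ a → a ≤ length L → 1 ≤ b → b ≤ length L →
              ∀ y → swap L a b ! y ≡ L ! transpose a b y
lookup-swap L {a} {b} 1≤a a≤len 1≤b b≤len zero =
  trans (lookup-zero (swap L a b)) (sym (trans (cong (L !_) (transpose-other (<⇒≢ 1≤a) (<⇒≢ 1≤b))) (lookup-zero L)))
lookup-swap L {a} {b} 1≤a a≤len 1≤b b≤len (suc y) with suc y ≤? length L
... | yes y<len = trans (lookup-map-positions _ (length L) (s≤s z≤n) y<len)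
                        (sym (trans (if-float (L !_) (suc y ≡ᵇ a))
                                    (cong (if suc y ≡ᵇ a then L ! b else_) (if-float (L !_) (suc y ≡ᵇ b)))))
... | no y≮len = trans (lookup-map-positions-beyond _ (length L) len<y)
                       (sym (trans (cong (L !_) (transpose-other (outside a≤len) (outside b≤len))) (lookup-beyond L len<y)))
  where
  len<y = ≰⇒> y≮len
  outside : ∀ {c} → c ≤ length L → suc y ≢ c
  outside c≤len refl = <⇒≱ len<y c≤len

swap-transposed : ∀ L {a b} → 1 ≤ a → a ≤ length L → 1 ≤ b → b ≤ length L → a ≢ b →
                  Transposed a b (L !_) (swap L a b !_)
swap-transposed L {a} {b} 1≤a a≤len 1≤b b≤len a≢b = record
  { at-a = trans (lookup-swap′ a) (cong (L !_) (transpose-a a b))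
  ; at-b = trans (lookup-swap′ b) (cong (L !_) (transpose-b a≢b))
  ; elsewhere = λ y y≢a y≢b → trans (lookup-swap′ y) (cong (L !_) (transpose-other y≢a y≢b))
  }
  where lookup-swap′ = lookup-swap L 1≤a a≤len 1≤b b≤len

≡-by-lookup : ∀ L M → length L ≡ length M → (∀ i → L ! i ≡ M ! i) → L ≡ M
≡-by-lookup [] [] _ _ = refl
≡-by-lookup (x ∷ L) (y ∷ M) len≡ L!≗M! = cong₂ _∷_ (L!≗M! 1) (≡-by-lookup L M (suc-injective len≡) tail!≗)
  where
  tail!≗ : ∀ i → L ! i ≡ M ! i
  tail!≗ zero = trans (lookup-zero L) (sym (lookup-zero M))
  tail!≗ (suc i) = L!≗M! (suc (suc i))

swap-involutive : ∀ L {a b} → 1 ≤ a → a ≤ length L → 1 ≤ b → b ≤ length L → a ≢ b → swap (swap L a b) a b ≡ L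
swap-involutive L {a} {b} 1≤a a≤len 1≤b b≤len a≢b =
  ≡-by-lookup (swap (swap L a b) a b) L (trans (length-swap (swap L a b) a b) (length-swap L a b)) λ y → begin
    swap (swap L a b) a b ! y          ≡⟨ lookup-swap (swap L a b) (1≤a) (≤-len a≤len) 1≤b (≤-len b≤len) y ⟩
    swap L a b ! transpose a b y       ≡⟨ lookup-swap L 1≤a a≤len 1≤b b≤len _ ⟩
    L ! transpose a b (transpose a b y) ≡⟨ cong (L !_) (transpose-involutive a≢b y) ⟩
    L ! y                              ∎
  where
  open ≡-Reasoning
  ≤-len : ∀ {c} → c ≤ length L → c ≤ length (swap L a b)
  ≤-len = subst (_ ≤_) (sym (length-swap L a b))

Distinct : List ℕ → Set
Distinct L = ∀ {i j} → 1 ≤ i → i ≤ length L → 1 ≤ j → j ≤ length L → L ! i ≡ L ! j → i ≡ j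

All≢-lookup : ∀ {x} L → All (x ≢_) L → ∀ {j} → 1 ≤ j → j ≤ length L → x ≢ L ! j
All≢-lookup (y ∷ L) (x≢y ∷ _) {suc zero} _ _ = x≢y
All≢-lookup (y ∷ L) (_ ∷ x≢L) {suc (suc j)} _ (s≤s j<len) = All≢-lookup L x≢L (s≤s z≤n) j<len

Unique-lookup : ∀ L → Unique L → ∀ {i j} → 1 ≤ i → i < j → j ≤ length L → L ! i ≢ L ! j
Unique-lookup (x ∷ L) _ {suc zero} {suc zero} _ (s≤s ()) _
Unique-lookup (x ∷ L) (x∉L ∷ _) {suc zero} {suc (suc j)} _ _ (s≤s j<len) = All≢-lookup L x∉L (s≤s z≤n) j<len
Unique-lookup (x ∷ L) (_ ∷ uniq) {suc (suc i)} {suc (suc j)} _ (s≤s i<j) (s≤s j<len) =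
  Unique-lookup L uniq (s≤s z≤n) i<j j<len

Unique⇒Distinct : ∀ {L} → Unique L → Distinct L
Unique⇒Distinct {L} uniq {i} {j} 1≤i i≤len 1≤j j≤len L!i≡L!j with <-cmp i j
... | tri< i<j _ _ = ⊥-elim (Unique-lookup L uniq 1≤i i<j j≤len L!i≡L!j)
... | tri≈ _ i≡j _ = i≡j
... | tri> _ _ j<i = ⊥-elim (Unique-lookup L uniq 1≤j j<i i≤len (sym L!i≡L!j))

IsPerm⇒Distinct : ∀ {n w} → IsPerm n w → Distinct w
IsPerm⇒Distinct {n} w↭positions = Unique⇒Distinct (Unique-resp-↭ (↭⇒↭ₛ (↭-sym w↭positions)) (map⁺ suc-injective (upTo⁺ n)))

swap-Distinct : ∀ L {a b} → 1 ≤ a → a ≤ length L → 1 ≤ b → b ≤ length L → a ≢ b → Distinct L → Distinct (swap L a b)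
swap-Distinct L {a} {b} 1≤a a≤len 1≤b b≤len a≢b distinct {i} {j} 1≤i i≤len′ 1≤j j≤len′ eq = begin
  i                                   ≡⟨ sym (transpose-involutive a≢b i) ⟩
  transpose a b (transpose a b i)     ≡⟨ cong (transpose a b) (distinct 1≤τi τi≤len 1≤τj τj≤len L!τi≡L!τj) ⟩
  transpose a b (transpose a b j)     ≡⟨ transpose-involutive a≢b j ⟩
  j                                   ∎
  where
  open ≡-Reasoning
  lookup-swap′ = lookup-swap L 1≤a a≤len 1≤b b≤len
  L!τi≡L!τj = trans (sym (lookup-swap′ i)) (trans eq (lookup-swap′ j))
  inRange : ∀ {y} → 1 ≤ y → y ≤ length (swap L a b) → 1 ≤ transpose a b y × transpose a b y ≤ length L
  inRange {y} 1≤y y≤len′ = transpose-inRange 1≤a a≤len 1≤b b≤len a≢b 1≤y (subst (y ≤_) (length-swap L a b) y≤len′)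
  τi = inRange 1≤i i≤len′
  τj = inRange 1≤j j≤len′
  1≤τi = proj₁ τi
  τi≤len = proj₂ τi
  1≤τj = proj₁ τj
  τj≤len = proj₂ τj

Distinct-between : ∀ {L k c j} → Distinct L → 1 ≤ k → k < c → c < j → j ≤ length L →
                   L ! c ≢ L ! k × L ! c ≢ L ! j
Distinct-between distinct 1≤k k<c c<j j≤len =
  (λ eq → <⇒≢ k<c (sym (distinct 1≤c c≤len 1≤k k≤len eq))) ,
  (λ eq → <⇒≢ c<j (distinct 1≤c c≤len (≤-trans 1≤c (<⇒≤ c<j)) j≤len eq))
  where
  1≤c = ≤-trans 1≤k (<⇒≤ k<c)
  c≤len = ≤-trans (<⇒≤ c<j) j≤len
  k≤len = ≤-trans (<⇒≤ (<-trans k<c c<j)) j≤len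

sandwiched-zero : ∀ f {a b} → (∀ c → a < c → c < b → ¬ (f a < f c × f c < f b)) → ∀ y → sandwiched f a b y ≡ 0
sandwiched-zero f {a} {b} empty y with a <? y | y <? b
... | no a≮y | _ = sandwiched-≤ f (≮⇒≥ a≮y)
... | yes _ | no y≮b = sandwiched-≥ f (≮⇒≥ y≮b)
... | yes a<y | yes y<b with f a <? f y | f y <? f b
...   | yes fa<fy | yes fy<fb = ⊥-elim (empty y a<y y<b (fa<fy , fy<fb))
...   | no fa≮fy | _ rewrite sandwiched-between f a<y y<b | <ᵇ-false (≮⇒≥ fa≮fy) = refl
...   | yes fa<fy | no fy≮fb rewrite sandwiched-between f a<y y<b | <ᵇ-true fa<fy | <ᵇ-false (≮⇒≥ fy≮fb) = refl

sandwiched-one : ∀ f {a b y} → a < y → y < b → f a < f y → f y < f b → sandwiched f a b y ≡ 1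
sandwiched-one f a<y y<b fa<fy fy<fb rewrite sandwiched-between f a<y y<b | <ᵇ-true fa<fy | <ᵇ-true fy<fb = refl

Covering : List ℕ → ℕ → ℕ → Set
Covering u k j = u ! k < u ! j × (∀ c → k < c → c < j → ¬ (u ! k < u ! c × u ! c < u ! j))

module _ (u : List ℕ) {k j : ℕ} (distinct : Distinct u) (1≤k : 1 ≤ k) (k<j : k < j) (j≤len : j ≤ length u) where

  private
    k≤len = ≤-trans (<⇒≤ k<j) j≤len
    1≤j = ≤-trans 1≤k (<⇒≤ k<j)
    j≤len′ = subst (j ≤_) (sym (length-swap u k j)) j≤len
    u↔swap = swap-transposed u 1≤k k≤len 1≤j j≤len (<⇒≢ k<j)
    sandwichedCount = sumTo (length u) (sandwiched (u !_) k j)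

    len-swap : len (swap u k j) ≡ inversions (swap u k j !_) (length u)
    len-swap = trans (len≡inversions (swap u k j)) (cong (inversions (swap u k j !_)) (length-swap u k j))

    len-swap-ascent : u ! k < u ! j → len (swap u k j) ≡ len u + suc (sandwichedCount + sandwichedCount)
    len-swap-ascent u!k<u!j = trans len-swap (inversions-transposition (length u) 1≤k k<j j≤len u↔swap u!k<u!j
      (λ c k<c c<j → Distinct-between {u} distinct 1≤k k<c c<j j≤len))

  Covering⇒InS : Covering u k j → InS u k j
  Covering⇒InS (u!k<u!j , nothing-between) = k<j , j≤len , (begin
    len (swap u k j)                                ≡⟨ len-swap-ascent u!k<u!j ⟩
    len u + suc (sandwichedCount + sandwichedCount) ≡⟨ cong (λ t → len u + suc (t + t)) count≡0 ⟩
    len u + 1                                       ≡⟨ +-comm (len u) 1 ⟩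
    suc (len u)                                     ∎)
    where
    open ≡-Reasoning
    count≡0 : sandwichedCount ≡ 0
    count≡0 = sumTo-zero (length u) _ (λ y _ _ → sandwiched-zero (u !_) nothing-between y)

  InS⇒Covering : InS u k j → Covering u k j
  InS⇒Covering (_ , _ , len-swap≡) with <-cmp (u ! k) (u ! j)
  ... | tri≈ _ u!k≡u!j _ = ⊥-elim (<⇒≢ k<j (distinct 1≤k k≤len 1≤j j≤len u!k≡u!j))
  ... | tri< u!k<u!j _ _ = u!k<u!j , nothing-between
    where
    count≡0 : sandwichedCount ≡ 0
    count≡0 = m+n≡0⇒m≡0 sandwichedCount (suc-injective (+-cancelˡ-≡ (len u) _ _
                (trans (sym (len-swap-ascent u!k<u!j)) (trans len-swap≡ (sym (+-comm (len u) 1))))))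
    nothing-between : ∀ c → k < c → c < j → ¬ (u ! k < u ! c × u ! c < u ! j)
    nothing-between c k<c c<j (u!k<u!c , u!c<u!j) = 1≢0 (trans (sym (sandwiched-one (u !_) k<c c<j u!k<u!c u!c<u!j))
      (sumTo≡0⇒ (length u) _ count≡0 c (≤-trans 1≤k (<⇒≤ k<c)) (≤-trans (<⇒≤ c<j) j≤len)))
      where
      1≢0 : 1 ≢ 0
      1≢0 ()
  ... | tri> _ _ u!j<u!k = ⊥-elim (1+n≰n (subst (suc (len u) ≤_) (sym descent) (m≤m+n (suc (len u)) _)))
    where
    open Transposed u↔swap
    swap-distinct = swap-Distinct u 1≤k k≤len 1≤j j≤len (<⇒≢ k<j) distinct
    swapCount = sumTo (length u) (sandwiched (swap u k j !_) k j)
    descent : len u ≡ suc (len u) + suc (swapCount + swapCount)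
    descent = trans (inversions-transposition (length u) 1≤k k<j j≤len (Transposed-sym u↔swap)
                       (subst₂ _<_ (sym at-a) (sym at-b) u!j<u!k)
                       (λ c k<c c<j → Distinct-between {swap u k j} swap-distinct 1≤k k<c c<j j≤len′))
                    (cong (_+ suc (swapCount + swapCount)) (trans (sym len-swap) len-swap≡))

module Proposition4p2 {n : ℕ} {w : List ℕ} {p q : ℕ}
                      (perm : IsPerm n w) (p-max : IsMax (Mid132 w) p) (q-max : IsMax (QSet w p) q) where

  private
    u = swap w p q

    1≤p : 1 ≤ p
    1≤p with proj₁ p-max
    ... | _ , _ , 1≤i , i<p , _ = ≤-trans 1≤i (<⇒≤ i<p)

    p<q = proj₁ (proj₁ q-max)
    q≤len = proj₁ (proj₂ (proj₁ q-max))
    w!q<w!p = proj₁ (proj₂ (proj₂ (proj₁ q-max)))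
    i₀ = proj₁ (proj₂ (proj₂ (proj₂ (proj₁ q-max))))
    1≤i₀ = proj₁ (proj₂ (proj₂ (proj₂ (proj₂ (proj₁ q-max)))))
    i₀<p = proj₁ (proj₂ (proj₂ (proj₂ (proj₂ (proj₂ (proj₁ q-max))))))
    w!i₀<w!q = proj₂ (proj₂ (proj₂ (proj₂ (proj₂ (proj₂ (proj₁ q-max))))))

    p≤len = ≤-trans (<⇒≤ p<q) q≤len
    1≤q = ≤-trans 1≤p (<⇒≤ p<q)
    w-distinct = IsPerm⇒Distinct perm
    w↔u = swap-transposed w 1≤p p≤len 1≤q q≤len (<⇒≢ p<q)
    open Transposed w↔u
    u-distinct = swap-Distinct w 1≤p p≤len 1≤q q≤len (<⇒≢ p<q) w-distinct

    no-mid-after-p : ∀ c → p < c → ¬ Mid132 w c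
    no-mid-after-p c p<c mid = <⇒≱ p<c (proj₂ p-max c mid)

    mid-before-q : ∀ {c} → p < c → c < q → w ! q < w ! c → Mid132 w c
    mid-before-q {c} p<c c<q w!q<w!c = i₀ , q , 1≤i₀ , <-trans i₀<p p<c , c<q , q≤len , w!i₀<w!q , w!q<w!c

    u!p<u!q : u ! p < u ! q
    u!p<u!q = subst₂ _<_ (sym at-a) (sym at-b) w!q<w!p

    q-covering : Covering u p q
    q-covering = u!p<u!q , λ c p<c c<q (u!p<u!c , _) →
      no-mid-after-p c p<c (mid-before-q p<c c<q (subst₂ _<_ at-a (elsewhere c (≢-sym (<⇒≢ p<c)) (<⇒≢ c<q)) u!p<u!c))

    beyond-q : ∀ {j} → q < j → j ≤ length w → w ! q < w ! j → w ! p < w ! j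
    beyond-q {j} q<j j≤len w!q<w!j with <-cmp (w ! j) (w ! p)
    ... | tri< w!j<w!p _ _ = ⊥-elim (<⇒≱ q<j (proj₂ q-max j (p<j , j≤len , w!j<w!p , i₀ , 1≤i₀ , i₀<p , <-trans w!i₀<w!q w!q<w!j)))
      where p<j = <-trans p<q q<j
    ... | tri≈ _ w!j≡w!p _ = ⊥-elim (<⇒≢ p<j (sym (w-distinct (≤-trans 1≤p (<⇒≤ p<j)) j≤len 1≤p p≤len w!j≡w!p)))
      where p<j = <-trans p<q q<j
    ... | tri> _ _ w!p<w!j = w!p<w!j

    covering⇒q : ∀ {j} → p < j → j ≤ length w → Covering u p j → j ≡ q
    covering⇒q {j} p<j j≤len (u!p<u!j , nothing-between) with <-cmp j q
    ... | tri≈ _ j≡q _ = j≡q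
    ... | tri< j<q _ _ = ⊥-elim (no-mid-after-p j p<j (mid-before-q p<j j<q w!q<w!j))
      where w!q<w!j = subst₂ _<_ at-a (elsewhere j (≢-sym (<⇒≢ p<j)) (<⇒≢ j<q)) u!p<u!j
    ... | tri> _ _ q<j = ⊥-elim (nothing-between q p<q q<j (u!p<u!q , subst₂ _<_ (sym at-b) (sym u!j≡w!j) w!p<w!j))
      where
      u!j≡w!j = elsewhere j (≢-sym (<⇒≢ (<-trans p<q q<j))) (≢-sym (<⇒≢ q<j))
      w!p<w!j = beyond-q q<j j≤len (subst₂ _<_ at-a u!j≡w!j u!p<u!j)

    q≤len′ = subst (q ≤_) (sym (length-swap w p q)) q≤len

  swap-back : swap u p q ≡ w
  swap-back = swap-involutive w 1≤p p≤len 1≤q q≤len (<⇒≢ p<q)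

  q∈S : InS u p q
  q∈S = Covering⇒InS u u-distinct 1≤p p<q q≤len′ q-covering

  S⊆q : ∀ {j} → InS u p j → j ≡ q
  S⊆q {j} j∈S@(p<j , j≤len′ , _) = covering⇒q p<j (subst (j ≤_) (length-swap w p q) j≤len′)
    (InS⇒Covering u u-distinct 1≤p p<j j≤len′ j∈S)

proposition4p2 : (n : ℕ) (w : List ℕ) → IsPerm n w → Contains132 w →
    (p q : ℕ) → IsMax (Mid132 w) p → IsMax (QSet w p) q →
    (v : List ℕ) → (PsiMem (swap w p q) p v → v ≡ w) × (v ≡ w → PsiMem (swap w p q) p v)
proposition4p2 n w perm _ p q p-max q-max v = sound , complete
  where
  open Proposition4p2 perm p-max q-max
  sound : PsiMem (swap w p q) p v → v ≡ w
  sound (direct {j = j} j∈S) = trans (cong (swap (swap w p q) p) (S⊆q j∈S)) swap-back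
  sound (extend S≡∅ _) = ⊥-elim (S≡∅ (q , q∈S))
  complete : v ≡ w → PsiMem (swap w p q) p v
  complete refl = subst (PsiMem (swap w p q) p) swap-back (direct q∈S)
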